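{- Let $\mathcal{M}$ be an $S4^\forall_\equiv$-model and $\gamma\colon V\rightarrow M$ an assignment. There exist a frame $(W,R)$ of modal logic $S4$, a valuation $g\colon V\rightarrow Pow(W)$ and a world $w\in W$ such that for all $\varphi,\psi\in Fm_m$: $(\mathcal{M},\gamma)\vDash\varphi\Leftrightarrow(w,g)\vDash\varphi$, and $(\mathcal{M},\gamma)\vDash\varphi\equiv\psi\Rightarrow(w,g)\vDash\square(\varphi\leftrightarrow\psi)$. Moreover, if $\mathcal{M}$ satisfies the Collapse Axiom and is a Boolean algebra, the latter implication is a biconditional.
   Context: Language: $Fm(C)$ is the set of formulas built from propositional variables $V$, a set $C$ of constants containing $\top,\bot$, connectives $\neg,\rightarrow,\vee,\wedge$, identity connective $\equiv$, necessity $\square$ and universal propositional quantifier $\forall$. $Fm_m\subseteq Fm(C)$ is the set of formulas of basic modal logic: quantifier-free, without $\equiv$, and with no constants other than $\bot,\top$. $\varphi\leftrightarrow\psi$ abbreviates $(\varphi\rightarrow\psi)\wedge(\psi\rightarrow\varphi)$. The Collapse Axiom is $(\square\varphi\wedge\square\psi)\rightarrow(\varphi\equiv\psi)$. Frames of $S4$ are Kripke frames $(W,R)$ with $R$ reflexive and transitive, with the usual Kripke satisfaction $(w,g)\vDash\varphi$. Models: a propositional domain is $\mathcal{M}=(M,\mathit{TRUE},\mathit{NEC},f_\bot,f_\top,f_\square,f_\neg,f_\vee,f_\wedge,f_\rightarrow,f_\equiv,f_\forall,\varGamma)$ with $\mathit{TRUE},\mathit{NEC}\subseteq M$, operations of obvious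 arities, $f_\forall\colon M^M\to M$, $\varGamma\colon C\to M$ with $\varGamma(\bot)=f_\bot,\varGamma(\top)=f_\top$; assignments $\gamma\colon V\to M$ extend homomorphically with $\gamma(c)=\varGamma(c)$ and $\gamma(\forall x\varphi)=f_\forall(m\mapsto\gamma_x^m(\varphi))$. $t\colon M\to M$ is $(\varphi,x,\gamma)$-definable if $t(m)=\gamma_x^m(\varphi)$ for all $m$ (definable if so for some $\varphi,x,\gamma$). With $a\le_\mathcal{M}b:\Leftrightarrow f_\rightarrow(a,b)\in\mathit{NEC}$ and $\approx_\mathcal{M}$ its symmetric part, $\mathcal{M}$ is an $S3^\forall_\equiv$-model if: (1) when $\mathit{NEC}\neq\varnothing$, $\le_\mathcal{M}$ is a preorder making $(M,f_\bot,f_\top,f_\neg,f_\vee,f_\wedge,f_\rightarrow,\le_\mathcal{M})$ a Boolean prealgebra ($\approx_\mathcal{M}$ a congruence with Boolean-algebra quotient ordered by $\le_\mathcal{M}$); (2) $f_\bot\notin\mathit{TRUE}$, $f_\top\in\mathit{TRUE}$, classical truth conditions for $f_\rightarrow,f_\neg,f_\wedge,f_\vee$, $f_\square(a)\in\mathit{TRUE}\Leftrightarrow a\in\mathit{NEC}$, $f_\equiv(a,b)\in\mathit{TRUE}\Leftrightarrow a=b$, $f_\forall(t)\in\mathit{TRUE}$ for definable $t$ with image in $\mathit{TRUE}$; (3) when $\mathit{NEC}\neq\varnothing$, $\mathit{NEC}\subseteq\mathit{TRUE}$ is upward closed under $\le_\mathcal{M}$ and closed under $f_\wedge$; (4) when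 $\mathit{NEC}\neq\varnothing$: $f_\top\le_\mathcal{M}f_\equiv(a,a)$; $f_\equiv(a,b)\le_\mathcal{M}f_\rightarrow(a,b)$; $f_\equiv(a,b)\le_\mathcal{M}f_\equiv(t(a),t(b))$ for definable $t$; $f_\square(a)\le_\mathcal{M}a$; $f_\square(f_\rightarrow(a,b))\le_\mathcal{M}f_\rightarrow(f_\square(a),f_\square(b))$; $f_\square(f_\rightarrow(a,b))\le_\mathcal{M}f_\square(f_\rightarrow(f_\square(a),f_\square(b)))$; $f_\forall(t)\le_\mathcal{M}f_\equiv(f_\forall(t_1),f_\forall(t_2))$ and $f_\forall(t)\le_\mathcal{M}f_\rightarrow(f_\forall(t_1),f_\forall(t_2))$ for $t_1,t_2$ $(\varphi,x,\gamma)$-, $(\psi,x,\gamma)$-definable and $t$ the pointwise $f_\equiv$, resp. $f_\rightarrow$, of $t_1,t_2$; $f_\forall(t)\le_\mathcal{M}t(a)$ for definable $t$; $f_\forall(t)\le_\mathcal{M}f_\rightarrow(b,f_\forall(t'))$ for $t'$ $(\psi,x,\gamma)$-definable, $b$ the denotation of a sentence and $t(a)=f_\rightarrow(b,t'(a))$; $f_\square(f_\forall(t))\approx_\mathcal{M}f_\forall(a\mapsto f_\square(t(a)))$ for definable $t$; $f_\forall(t)\in\mathit{NEC}$ for definable $t$ with image in $\mathit{NEC}$. It is normal if $\mathit{NEC}\neq\varnothing$. A normal $S3^\forall_\equiv$-model is an $S4^\forall_\equiv$-model if $f_\square(a)\le_\mathcal{M}f_\square(f_\square(a))$ for all $a$.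 $(\mathcal{M},\gamma)\vDash\varphi:\Leftrightarrow\gamma(\varphi)\in\mathit{TRUE}$. "$\mathcal{M}$ is a Boolean algebra" refers to $(M,f_\bot,f_\top,f_\neg,f_\vee,f_\wedge,f_\rightarrow)$. -}

module Defs where

open import Level using (Lift; lift; _⊔_)
open import Data.Nat using (ℕ; _≟_)
open import Data.Bool using (if_then_else_)
open import Data.Product using (Σ; _×_; _,_)
open import Data.Sum using (_⊎_)
open import Data.Empty using (⊥)
open import Data.Unit using (⊤)
open import Relation.Nullary using (¬_; does)
open import Relation.Binary.PropositionalEquality using (_≡_)
open import Algebra.Lattice.Structures using (IsBooleanAlgebra)

infixr 6 _∧'_
infixr 5 _∨'_
infixr 4 _⇒'_
infix 3 _≡'_

-- The language Fm(C).  Propositional variables V = ℕ.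
-- The argument C is the set of constants OTHER than ⊤ and ⊥; the
-- constants ⊤, ⊥ are the constructors ⊤' and ⊥'.

data Fm (C : Set) : Set where
  var  : ℕ → Fm C
  con  : C → Fm C
  ⊥' ⊤' : Fm C
  ¬'   : Fm C → Fm C
  _⇒'_ _∨'_ _∧'_ _≡'_ : Fm C → Fm C → Fm C
  □'   : Fm C → Fm C
  ∀'   : ℕ → Fm C → Fm C

data Free {C : Set} (x : ℕ) : Fm C → Set where
  fvar : Free x (var x)
  fr¬   : ∀ {φ} → Free x φ → Free x (¬' φ)
  fr⇒ˡ  : ∀ {φ ψ} → Free x φ → Free x (φ ⇒' ψ)
  fr⇒ʳ  : ∀ {φ ψ} → Free x ψ → Free x (φ ⇒' ψ)
  fr∨ˡ  : ∀ {φ ψ} → Free x φ → Free x (φ ∨' ψ)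
  fr∨ʳ  : ∀ {φ ψ} → Free x ψ → Free x (φ ∨' ψ)
  fr∧ˡ  : ∀ {φ ψ} → Free x φ → Free x (φ ∧' ψ)
  fr∧ʳ  : ∀ {φ ψ} → Free x ψ → Free x (φ ∧' ψ)
  fr≡ˡ  : ∀ {φ ψ} → Free x φ → Free x (φ ≡' ψ)
  fr≡ʳ  : ∀ {φ ψ} → Free x ψ → Free x (φ ≡' ψ)
  fr□   : ∀ {φ} → Free x φ → Free x (□' φ)
  fr∀   : ∀ {y φ} → ¬ (x ≡ y) → Free x φ → Free x (∀' y φ)

Sentence : {C : Set} → Fm C → Set
Sentence φ = ∀ x → ¬ Free x φ

-- Fm_m : formulas of basic modal logic (quantifier-free, no ≡, only the
-- constants ⊥, ⊤), given as a datatype with its embedding into Fm(C).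

data MFm : Set where
  mvar : ℕ → MFm
  m⊥ m⊤ : MFm
  m¬ : MFm → MFm
  _m⇒_ _m∨_ _m∧_ : MFm → MFm → MFm
  m□ : MFm → MFm

ι : {C : Set} → MFm → Fm C
ι (mvar p)  = var p
ι m⊥        = ⊥'
ι m⊤        = ⊤'
ι (m¬ φ)    = ¬' (ι φ)
ι (φ m⇒ ψ)  = ι φ ⇒' ι ψ
ι (φ m∨ ψ)  = ι φ ∨' ι ψ
ι (φ m∧ ψ)  = ι φ ∧' ι ψ
ι (m□ φ)    = □' (ι φ)

_m↔_ : MFm → MFm → MFm
φ m↔ ψ = (φ m⇒ ψ) m∧ (ψ m⇒ φ)

_⇔_ : ∀ {a b} → Set a → Set b → Set (a ⊔ b)
A ⇔ B = (A → B) × (B → A)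

record PropDomain (C : Set) : Set₁ where
  field
    M    : Set
    TRUE : M → Set
    NEC  : M → Set
    f⊥ f⊤ : M
    f□ f¬ : M → M
    f∨ f∧ f⇒ f≡ : M → M → M
    f∀   : (M → M) → M
    Γ    : C → M

module Semantics {C : Set} (D : PropDomain C) where
  open PropDomain D

  upd : (ℕ → M) → ℕ → M → (ℕ → M)
  upd γ x m y = if does (x ≟ y) then m else γ y

  ⟦_⟧ : Fm C → (ℕ → M) → M
  ⟦ var p ⟧ γ    = γ p
  ⟦ con c ⟧ γ    = Γ c
  ⟦ ⊥' ⟧ γ       = f⊥
  ⟦ ⊤' ⟧ γ       = f⊤
  ⟦ ¬' φ ⟧ γ     = f¬ (⟦ φ ⟧ γ)
  ⟦ φ ⇒' ψ ⟧ γ   = f⇒ (⟦ φ ⟧ γ) (⟦ ψ ⟧ γ)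
  ⟦ φ ∨' ψ ⟧ γ   = f∨ (⟦ φ ⟧ γ) (⟦ ψ ⟧ γ)
  ⟦ φ ∧' ψ ⟧ γ   = f∧ (⟦ φ ⟧ γ) (⟦ ψ ⟧ γ)
  ⟦ φ ≡' ψ ⟧ γ   = f≡ (⟦ φ ⟧ γ) (⟦ ψ ⟧ γ)
  ⟦ □' φ ⟧ γ     = f□ (⟦ φ ⟧ γ)
  ⟦ ∀' x φ ⟧ γ   = f∀ (λ m → ⟦ φ ⟧ (upd γ x m))

  dfn : Fm C → ℕ → (ℕ → M) → M → M
  dfn φ x γ m = ⟦ φ ⟧ (upd γ x m)

  _⊨_ : (ℕ → M) → Fm C → Set
  γ ⊨ φ = TRUE (⟦ φ ⟧ γ)

  _≤M_ : M → M → Set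
  a ≤M b = NEC (f⇒ a b)

  _≈M_ : M → M → Set
  a ≈M b = (a ≤M b) × (b ≤M a)

  NECnonempty : Set
  NECnonempty = Σ M NEC

  record IsBooleanPrealgebra : Set where
    field
      ≤-refl    : ∀ a → a ≤M a
      ≤-trans   : ∀ a b c → a ≤M b → b ≤M c → a ≤M c
      isBA      : IsBooleanAlgebra _≈M_ f∨ f∧ f¬ f⊤ f⊥
      ⇒-cong    : ∀ a a' b b' → a ≈M a' → b ≈M b' → f⇒ a b ≈M f⇒ a' b'
      ⇒-def     : ∀ a b → f⇒ a b ≈M f∨ (f¬ a) b
      ≤-is-order : ∀ a b → (a ≤M b) ⇔ (f∧ a b ≈M a)

  record IsS3Model : Set₁ where
    field
      boolPre : NECnonempty → IsBooleanPrealgebra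
      ⊥-false : ¬ TRUE f⊥
      ⊤-true  : TRUE f⊤
      ⇒-true  : ∀ a b → TRUE (f⇒ a b) ⇔ (TRUE a → TRUE b)
      ¬-true  : ∀ a → TRUE (f¬ a) ⇔ (¬ TRUE a)
      ∧-true  : ∀ a b → TRUE (f∧ a b) ⇔ (TRUE a × TRUE b)
      ∨-true  : ∀ a b → TRUE (f∨ a b) ⇔ (TRUE a ⊎ TRUE b)
      □-true  : ∀ a → TRUE (f□ a) ⇔ NEC a
      ≡-true  : ∀ a b → TRUE (f≡ a b) ⇔ (a ≡ b)
      ∀-true  : ∀ φ x γ → (∀ m → TRUE (dfn φ x γ m)) → TRUE (f∀ (dfn φ x γ))
      NEC⊆TRUE : NECnonempty → ∀ a → NEC a → TRUE a
      NEC-up   : NECnonempty → ∀ a b → NEC a → a ≤M b → NEC b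
      NEC-∧    : NECnonempty → ∀ a b → NEC a → NEC b → NEC (f∧ a b)
      ax-≡refl : NECnonempty → ∀ a → f⊤ ≤M f≡ a a
      ax-≡⇒    : NECnonempty → ∀ a b → f≡ a b ≤M f⇒ a b
      ax-≡sub  : NECnonempty → ∀ φ x γ a b →
                   f≡ a b ≤M f≡ (dfn φ x γ a) (dfn φ x γ b)
      ax-T     : NECnonempty → ∀ a → f□ a ≤M a
      ax-K     : NECnonempty → ∀ a b → f□ (f⇒ a b) ≤M f⇒ (f□ a) (f□ b)
      ax-S3    : NECnonempty → ∀ a b →
                   f□ (f⇒ a b) ≤M f□ (f⇒ (f□ a) (f□ b))
      ax-∀≡    : NECnonempty → ∀ φ ψ x γ →
                   f∀ (λ m → f≡ (dfn φ x γ m) (dfn ψ x γ m))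
                     ≤M f≡ (f∀ (dfn φ x γ)) (f∀ (dfn ψ x γ))
      ax-∀⇒    : NECnonempty → ∀ φ ψ x γ →
                   f∀ (λ m → f⇒ (dfn φ x γ m) (dfn ψ x γ m))
                     ≤M f⇒ (f∀ (dfn φ x γ)) (f∀ (dfn ψ x γ))
      ax-∀inst : NECnonempty → ∀ φ x γ a → f∀ (dfn φ x γ) ≤M dfn φ x γ a
      ax-∀vac  : NECnonempty → ∀ χ δ → Sentence χ → ∀ ψ x γ →
                   f∀ (λ m → f⇒ (⟦ χ ⟧ δ) (dfn ψ x γ m))
                     ≤M f⇒ (⟦ χ ⟧ δ) (f∀ (dfn ψ x γ))
      ax-BF    : NECnonempty → ∀ φ x γ →
                   f□ (f∀ (dfn φ x γ)) ≈M f∀ (λ m → f□ (dfn φ x γ m))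
      ax-∀NEC  : NECnonempty → ∀ φ x γ →
                   (∀ m → NEC (dfn φ x γ m)) → NEC (f∀ (dfn φ x γ))

  record IsS4Model : Set₁ where
    field
      isS3   : IsS3Model
      normal : NECnonempty
      ax-4   : ∀ a → f□ a ≤M f□ (f□ a)

  SatisfiesCollapse : Set
  SatisfiesCollapse = ∀ (φ ψ : Fm C) (γ : ℕ → M) →
    TRUE (⟦ (□' φ ∧' □' ψ) ⇒' (φ ≡' ψ) ⟧ γ)

  IsBooleanAlgebraM : Set
  IsBooleanAlgebraM = IsBooleanAlgebra _≡_ f∨ f∧ f¬ f⊤ f⊥ ×
                      (∀ a b → f⇒ a b ≡ f∨ (f¬ a) b)

record S4Frame : Set₂ where
  field
    W     : Set₁
    R     : W → W → Set₁
    refl  : ∀ w → R w w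
    trans : ∀ u v w → R u v → R v w → R u w

module Kripke (F : S4Frame) where
  open S4Frame F

  _,_⊩_ : W → (ℕ → W → Set) → MFm → Set₁
  w , g ⊩ mvar p  = Lift _ (g p w)
  w , g ⊩ m⊥      = Lift _ ⊥
  w , g ⊩ m⊤      = Lift _ ⊤
  w , g ⊩ m¬ φ    = ¬ (w , g ⊩ φ)
  w , g ⊩ (φ m⇒ ψ) = (w , g ⊩ φ) → (w , g ⊩ ψ)
  w , g ⊩ (φ m∨ ψ) = (w , g ⊩ φ) ⊎ (w , g ⊩ ψ)
  w , g ⊩ (φ m∧ ψ) = (w , g ⊩ φ) × (w , g ⊩ ψ)
  w , g ⊩ m□ φ    = ∀ v → R w v → v , g ⊩ φ

-- A canonical-model argument. The formulas φ of Fm_m with NEC ⟦φ⟧γ form a normal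
-- modal logic containing S4 (axiom 4 yields necessitation), so its maximal consistent
-- theories, with v R u iff □φ ∈ v implies φ ∈ u, form an S4 frame satisfying the truth
-- lemma. The set {φ | γ ⊨ φ} is one of these worlds, since TRUE is classical and
-- contains NEC. Maximal consistent extensions are built constructively, deciding the
-- formulas of an explicit enumeration of Fm_m one at a time; membership in a complete
-- theory is decidable. An identity ⟦φ⟧ = ⟦ψ⟧ makes φ ↔ ψ necessary; conversely,
-- under Collapse, □(φ ↔ ψ) together with □⊤ gives ⟦φ ↔ ψ⟧ = ⊤, which in a Boolean
-- algebra means ⟦φ⟧ = ⟦ψ⟧.

module Submission where

open import Defs
open import Level using (Lift; lift; lower)
open import Data.Nat using (ℕ; _≤_; z≤n; zero; suc; _⊔_; _≤′_; ≤′-refl; ≤′-step)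
open import Data.Nat.Properties using (≤⇒≤′; m≤m⊔n; m≤n⊔m)
open import Data.List using (List; []; _∷_; _++_; foldl; concatMap)
open import Data.List.Membership.Propositional using (_∈_; lose)
open import Data.List.Membership.Propositional.Properties
  using (∈-++⁺ˡ; ∈-++⁺ʳ; ∈-concatMap⁺)
open import Data.List.Relation.Binary.Subset.Propositional using (_⊆_)
open import Data.List.Relation.Unary.Any using (here; there)
open import Data.Product using (Σ; ∃-syntax; _×_; _,_; proj₁; proj₂)
open import Data.Sum using (_⊎_; inj₁; inj₂)
open import Data.Unit using (tt)
open import Data.Empty using (⊥-elim)
open import Relation.Nullary using (¬_; yes; no)
open import Relation.Unary using (Decidable)
open import Relation.Binary.PropositionalEquality using (_≡_; refl; sym; trans; cong₂; subst)
open import Algebra.Lattice.Bundles using (BooleanAlgebra)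
import Algebra.Lattice.Properties.BooleanAlgebra as BooleanAlgebraProperties
import Algebra.Lattice.Properties.Lattice as LatticeProperties
import Relation.Binary.Lattice as OrderLattice
import Relation.Binary.Reasoning.Setoid as SetoidReasoning

compoundsOver : List MFm → MFm → List MFm
compoundsOver L φ = m¬ φ ∷ m□ φ ∷ concatMap (λ ψ → (φ m⇒ ψ) ∷ (φ m∨ ψ) ∷ (φ m∧ ψ) ∷ []) L

formulasUpTo : ℕ → List MFm
formulasUpTo zero    = m⊥ ∷ m⊤ ∷ []
formulasUpTo (suc n) = formulasUpTo n ++ (mvar n ∷ concatMap (compoundsOver L) L)
  where L = formulasUpTo n

formulasUpTo-mono : ∀ {m n} → m ≤′ n → formulasUpTo m ⊆ formulasUpTo n
formulasUpTo-mono ≤′-refl       = λ i → i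
formulasUpTo-mono (≤′-step m≤n) = λ i → ∈-++⁺ˡ (formulasUpTo-mono m≤n i)

formulasUpTo-common : ∀ {φ ψ} → ∃[ m ] φ ∈ formulasUpTo m → ∃[ n ] ψ ∈ formulasUpTo n →
                      ∃[ k ] (φ ∈ formulasUpTo k × ψ ∈ formulasUpTo k)
formulasUpTo-common (m , i) (n , j) =
  m ⊔ n , formulasUpTo-mono (≤⇒≤′ (m≤m⊔n m n)) i , formulasUpTo-mono (≤⇒≤′ (m≤n⊔m m n)) j

∈-concatMap : ∀ {A B : Set} {f : A → List B} {x xs y} → x ∈ xs → y ∈ f x → y ∈ concatMap f xs
∈-concatMap {f = f} x∈xs y∈fx = ∈-concatMap⁺ f (lose x∈xs y∈fx)

∈-formulasUpTo-suc : ∀ {n φ θ} → φ ∈ formulasUpTo n → θ ∈ compoundsOver (formulasUpTo n) φ →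
                     θ ∈ formulasUpTo (suc n)
∈-formulasUpTo-suc {n} i j = ∈-++⁺ʳ (formulasUpTo n) (there (∈-concatMap i j))

formulasUpTo-complete : ∀ θ → ∃[ n ] θ ∈ formulasUpTo n
formulasUpTo-complete (mvar p) = suc p , ∈-++⁺ʳ (formulasUpTo p) (here refl)
formulasUpTo-complete m⊥       = zero , here refl
formulasUpTo-complete m⊤       = zero , there (here refl)
formulasUpTo-complete (m¬ φ) with formulasUpTo-complete φ
... | n , i = suc n , ∈-formulasUpTo-suc i (here refl)
formulasUpTo-complete (m□ φ) with formulasUpTo-complete φ
... | n , i = suc n , ∈-formulasUpTo-suc i (there (here refl))
formulasUpTo-complete (φ m⇒ ψ)
  with formulasUpTo-common (formulasUpTo-complete φ) (formulasUpTo-complete ψ)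
... | n , i , j = suc n , ∈-formulasUpTo-suc i (there (there (∈-concatMap j (here refl))))
formulasUpTo-complete (φ m∨ ψ)
  with formulasUpTo-common (formulasUpTo-complete φ) (formulasUpTo-complete ψ)
... | n , i , j = suc n , ∈-formulasUpTo-suc i (there (there (∈-concatMap j (there (here refl)))))
formulasUpTo-complete (φ m∧ ψ)
  with formulasUpTo-common (formulasUpTo-complete φ) (formulasUpTo-complete ψ)
... | n , i , j = suc n , ∈-formulasUpTo-suc i (there (there (∈-concatMap j (there (there (here refl))))))

module _ {c ℓ} (B : BooleanAlgebra c ℓ) where
  open BooleanAlgebra B renaming (¬_ to ∁_; trans to ≈-trans)
  open BooleanAlgebraProperties B
  open SetoidReasoning setoid

  x∧y≈⊤⇒x≈⊤ : ∀ x y → x ∧ y ≈ ⊤ → x ≈ ⊤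
  x∧y≈⊤⇒x≈⊤ x y h = begin
    x           ≈⟨ ∨-absorbs-∧ x y ⟨
    x ∨ (x ∧ y) ≈⟨ ∨-congˡ h ⟩
    x ∨ ⊤       ≈⟨ ∨-zeroʳ x ⟩
    ⊤           ∎

  ∁x∨y≈⊤⇒x≈x∧y : ∀ x y → ∁ x ∨ y ≈ ⊤ → x ≈ x ∧ y
  ∁x∨y≈⊤⇒x≈x∧y x y h = begin
    x                   ≈⟨ ∧-identityʳ x ⟨
    x ∧ ⊤               ≈⟨ ∧-congˡ h ⟨
    x ∧ (∁ x ∨ y)       ≈⟨ ∧-distribˡ-∨ x (∁ x) y ⟩
    (x ∧ ∁ x) ∨ (x ∧ y) ≈⟨ ∨-congʳ (∧-complementʳ x) ⟩
    ⊥ ∨ (x ∧ y)         ≈⟨ ∨-identityˡ (x ∧ y) ⟩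
    x ∧ y               ∎

  [∁x∨y]∧[∁y∨x]≈⊤⇒x≈y : ∀ x y → (∁ x ∨ y) ∧ (∁ y ∨ x) ≈ ⊤ → x ≈ y
  [∁x∨y]∧[∁y∨x]≈⊤⇒x≈y x y h = begin
    x     ≈⟨ ∁x∨y≈⊤⇒x≈x∧y x y (x∧y≈⊤⇒x≈⊤ _ _ h) ⟩
    x ∧ y ≈⟨ ∧-comm x y ⟩
    y ∧ x ≈⟨ ∁x∨y≈⊤⇒x≈x∧y y x (x∧y≈⊤⇒x≈⊤ _ _ (≈-trans (∧-comm _ _) h)) ⟨
    y     ∎

module Prealgebra {C : Set} (D : PropDomain C) (BP : Semantics.IsBooleanPrealgebra D) where
  open PropDomain D
  open Semantics D
  open IsBooleanPrealgebra BP using (isBA; ⇒-def; ≤-is-order)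

  private
    quotient : BooleanAlgebra _ _
    quotient = record { _≈_ = _≈M_ ; _∨_ = f∨ ; _∧_ = f∧ ; ¬_ = f¬ ; ⊤ = f⊤ ; ⊥ = f⊥
                      ; isBooleanAlgebra = isBA }
    module Q = BooleanAlgebra quotient
    module QP = BooleanAlgebraProperties quotient
    module QO = OrderLattice.Lattice (LatticeProperties.∨-∧-orderTheoreticLattice Q.lattice)

    fromLattice : ∀ {a b} → QO._≤_ a b → a ≤M b
    fromLattice {a} {b} h = proj₂ (≤-is-order a b) (Q.sym h)

    toLattice : ∀ {a b} → a ≤M b → QO._≤_ a b
    toLattice {a} {b} h = Q.sym (proj₁ (≤-is-order a b) h)

  infixr 5 _⨾_

  ≤-refl : ∀ {a} → a ≤M a
  ≤-refl {a} = IsBooleanPrealgebra.≤-refl BP a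

  _⨾_ : ∀ {a b c} → a ≤M b → b ≤M c → a ≤M c
  _⨾_ {a} {b} {c} = IsBooleanPrealgebra.≤-trans BP a b c

  ≈⇒≤ : ∀ {a b} → a ≈M b → a ≤M b
  ≈⇒≤ e = fromLattice (QO.reflexive e)

  x∧y≤x : ∀ {a b} → f∧ a b ≤M a
  x∧y≤x {a} {b} = fromLattice (QO.x∧y≤x a b)

  x∧y≤y : ∀ {a b} → f∧ a b ≤M b
  x∧y≤y {a} {b} = fromLattice (QO.x∧y≤y a b)

  ∧-greatest : ∀ {c a b} → c ≤M a → c ≤M b → c ≤M f∧ a b
  ∧-greatest h k = fromLattice (QO.∧-greatest (toLattice h) (toLattice k))

  x≤x∨y : ∀ {a b} → a ≤M f∨ a b
  x≤x∨y {a} {b} = fromLattice (QO.x≤x∨y a b)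

  y≤x∨y : ∀ {a b} → b ≤M f∨ a b
  y≤x∨y {a} {b} = fromLattice (QO.y≤x∨y a b)

  ∨-least : ∀ {a b c} → a ≤M c → b ≤M c → f∨ a b ≤M c
  ∨-least h k = fromLattice (QO.∨-least (toLattice h) (toLattice k))

  ⊥-least : ∀ {a} → f⊥ ≤M a
  ⊥-least {a} = fromLattice (Q.sym (QP.∧-zeroˡ a))

  ⊤-greatest : ∀ {a} → a ≤M f⊤
  ⊤-greatest {a} = fromLattice (Q.sym (QP.∧-identityʳ a))

  ∧-comm-≤ : ∀ {a b} → f∧ a b ≤M f∧ b a
  ∧-comm-≤ = ∧-greatest x∧y≤y x∧y≤x

  excluded-middle : ∀ {a} → f⊤ ≤M f∨ a (f¬ a)
  excluded-middle {a} = ≈⇒≤ (Q.sym (Q.∨-complementʳ a))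

  ∧-complement : ∀ {a} → f∧ a (f¬ a) ≤M f⊥
  ∧-complement {a} = ≈⇒≤ (Q.∧-complementʳ a)

  ∨-elim : ∀ {c a b d} → f∧ c a ≤M d → f∧ c b ≤M d → f∧ c (f∨ a b) ≤M d
  ∨-elim h k = ≈⇒≤ (Q.∧-distribˡ-∨ _ _ _) ⨾ ∨-least h k

  by-cases : ∀ t {c d} → f∧ c t ≤M d → f∧ c (f¬ t) ≤M d → c ≤M d
  by-cases t h k = ∧-greatest ≤-refl (⊤-greatest ⨾ excluded-middle) ⨾ ∨-elim h k

  ¬-elim : ∀ {c a} → c ≤M a → c ≤M f¬ a → c ≤M f⊥
  ¬-elim h k = ∧-greatest h k ⨾ ∧-complement

  ¬-intro : ∀ {c a} → f∧ c a ≤M f⊥ → c ≤M f¬ a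
  ¬-intro h = by-cases _ (h ⨾ ⊥-least) x∧y≤y

  ¬¬-elim : ∀ {a} → f¬ (f¬ a) ≤M a
  ¬¬-elim {a} = ≈⇒≤ (QP.¬-involutive a)

  ⇒-intro : ∀ {c a b} → f∧ c a ≤M b → c ≤M f⇒ a b
  ⇒-intro {a = a} {b} h = by-cases a (h ⨾ y≤x∨y) (x∧y≤y ⨾ x≤x∨y) ⨾ proj₂ (⇒-def a b)

  ⇒-elim : ∀ {c a b} → c ≤M a → c ≤M f⇒ a b → c ≤M b
  ⇒-elim {a = a} {b} h k =
    ∧-greatest (k ⨾ proj₁ (⇒-def a b)) h ⨾ ∧-comm-≤ ⨾ ∨-elim (∧-complement ⨾ ⊥-least) x∧y≤y

module S4Calculus {C : Set} (D : PropDomain C) (S4 : Semantics.IsS4Model D) where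
  open PropDomain D
  open Semantics D
  open IsS4Model S4
  open IsS3Model isS3
  open Prealgebra D (boolPre normal) public

  NEC-≤ : ∀ {a b} → NEC a → a ≤M b → NEC b
  NEC-≤ {a} {b} = NEC-up normal a b

  NEC-⊤ : NEC f⊤
  NEC-⊤ = NEC-≤ (proj₂ normal) ⊤-greatest

  NEC-mp : ∀ {a b} → NEC a → NEC (f⇒ a b) → NEC b
  NEC-mp {a} {b} h k = NEC-≤ (NEC-∧ normal a (f⇒ a b) h k) (⇒-elim x∧y≤x x∧y≤y)

  NEC⇒⊤≤ : ∀ {a} → NEC a → f⊤ ≤M a
  NEC⇒⊤≤ h = NEC-≤ h (⇒-intro x∧y≤x)

  ⊤≤⇒NEC : ∀ {a} → f⊤ ≤M a → NEC a
  ⊤≤⇒NEC = NEC-mp NEC-⊤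

  -- Axiom 4 turns the truth of □a into the necessity of □a.
  NEC-□ : ∀ {a} → NEC a → NEC (f□ a)
  NEC-□ {a} h = proj₁ (□-true (f□ a))
    (proj₁ (⇒-true _ _) (NEC⊆TRUE normal _ (ax-4 a)) (proj₂ (□-true a) h))

  □-mono : ∀ {a b} → a ≤M b → f□ a ≤M f□ b
  □-mono {a} {b} h = NEC-≤ (NEC-□ h) (ax-K normal a b)

  □-∧ : ∀ {a b} → f∧ (f□ a) (f□ b) ≤M f□ (f∧ a b)
  □-∧ {a} {b} = ⇒-elim x∧y≤y (x∧y≤x ⨾ □-mono (⇒-intro ≤-refl) ⨾ ax-K normal b (f∧ a b))

  □-T : ∀ {a} → f□ a ≤M a
  □-T {a} = ax-T normal a

  □-4 : ∀ {a} → f□ a ≤M f□ (f□ a)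
  □-4 {a} = ax-4 a

  TRUE-or-TRUE-¬ : ∀ a → TRUE a ⊎ TRUE (f¬ a)
  TRUE-or-TRUE-¬ a = proj₁ (∨-true a (f¬ a)) (NEC⊆TRUE normal _ (⊤≤⇒NEC excluded-middle))

-- Lindenbaum's construction relative to a decidable notion of inconsistency Bad:
-- each enumerated θ or its negation is conjoined in turn without becoming Bad.
module Lindenbaum {C : Set} (D : PropDomain C) (BP : Semantics.IsBooleanPrealgebra D)
                  (γ : ℕ → PropDomain.M D) (Bad : MFm → Set) (bad? : Decidable Bad)
                  (bad-split : ∀ α θ → Bad (α m∧ θ) → Bad (α m∧ m¬ θ) → Bad α) where
  open PropDomain D
  open Semantics D
  open Prealgebra D BP

  private
    e : MFm → M
    e φ = ⟦ ι φ ⟧ γ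

  Decides : MFm → MFm → Set
  Decides α θ = e α ≤M e θ ⊎ e α ≤M f¬ (e θ)

  extend : MFm → MFm → MFm
  extend α θ with bad? (α m∧ θ)
  ... | yes _ = α m∧ m¬ θ
  ... | no  _ = α m∧ θ

  extend-good : ∀ {α} θ → ¬ Bad α → ¬ Bad (extend α θ)
  extend-good {α} θ good with bad? (α m∧ θ)
  ... | yes bad = λ bad¬ → good (bad-split α θ bad bad¬)
  ... | no good∧ = good∧

  extend-≤ : ∀ α θ → e (extend α θ) ≤M e α
  extend-≤ α θ with bad? (α m∧ θ)
  ... | yes _ = x∧y≤x
  ... | no  _ = x∧y≤x

  extend-decides : ∀ α θ → Decides (extend α θ) θ
  extend-decides α θ with bad? (α m∧ θ)
  ... | yes _ = inj₂ x∧y≤y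
  ... | no  _ = inj₁ x∧y≤y

  extendAll : MFm → List MFm → MFm
  extendAll = foldl extend

  extendAll-good : ∀ {α} L → ¬ Bad α → ¬ Bad (extendAll α L)
  extendAll-good []      good = good
  extendAll-good (θ ∷ L) good = extendAll-good L (extend-good θ good)

  extendAll-≤ : ∀ α L → e (extendAll α L) ≤M e α
  extendAll-≤ α []      = ≤-refl
  extendAll-≤ α (θ ∷ L) = extendAll-≤ (extend α θ) L ⨾ extend-≤ α θ

  extendAll-decides : ∀ α {L θ} → θ ∈ L → Decides (extendAll α L) θ
  extendAll-decides α {θ ∷ L} (here refl) with extend-decides α θ
  ... | inj₁ h = inj₁ (extendAll-≤ (extend α θ) L ⨾ h)
  ... | inj₂ h = inj₂ (extendAll-≤ (extend α θ) L ⨾ h)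
  extendAll-decides α {θ' ∷ L} (there i) = extendAll-decides (extend α θ') i

  chain : MFm → ℕ → MFm
  chain α zero    = α
  chain α (suc n) = extendAll (chain α n) (formulasUpTo n)

  chain-good : ∀ {α} n → ¬ Bad α → ¬ Bad (chain α n)
  chain-good zero    good = good
  chain-good (suc n) good = extendAll-good (formulasUpTo n) (chain-good n good)

  chain-antitone : ∀ α {m n} → m ≤′ n → e (chain α n) ≤M e (chain α m)
  chain-antitone α ≤′-refl = ≤-refl
  chain-antitone α (≤′-step {n} m≤n) =
    extendAll-≤ (chain α n) (formulasUpTo n) ⨾ chain-antitone α m≤n

  chain-decides : ∀ α θ → ∃[ n ] Decides (chain α n) θ
  chain-decides α θ with formulasUpTo-complete θ
  ... | n , i = suc n , extendAll-decides (chain α n) i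

module Canonical {C : Set} (D : PropDomain C) (S4 : Semantics.IsS4Model D) (γ : ℕ → PropDomain.M D) where
  open PropDomain D
  open Semantics D
  open IsS4Model S4 using (isS3; normal)
  open IsS3Model isS3
  open S4Calculus D S4

  e : MFm → M
  e φ = ⟦ ι φ ⟧ γ

  -- A maximal consistent theory of the modal logic {φ | NEC (e φ)}.
  record World : Set₁ where
    field
      Holds      : MFm → Set
      theorems   : ∀ φ → NEC (e φ) → Holds φ
      mp         : ∀ φ ψ → Holds (φ m⇒ ψ) → Holds φ → Holds ψ
      consistent : ¬ Holds m⊥
      complete   : ∀ φ → Holds φ ⊎ Holds (m¬ φ)

    holds-≤ : ∀ {φ ψ} → Holds φ → e φ ≤M e ψ → Holds ψ
    holds-≤ {φ} {ψ} p h = mp φ ψ (theorems (φ m⇒ ψ) (⊤≤⇒NEC (⇒-intro (x∧y≤y ⨾ h)))) p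

    holds-∧≤ : ∀ {φ ψ χ} → Holds φ → Holds ψ → f∧ (e φ) (e ψ) ≤M e χ → Holds χ
    holds-∧≤ {ψ = ψ} {χ} p q h = mp ψ χ (holds-≤ p (⇒-intro h)) q

    holds-□≤ : ∀ {φ ψ} → Holds (m□ φ) → e φ ≤M e ψ → Holds (m□ ψ)
    holds-□≤ p h = holds-≤ p (□-mono h)

    holds-□∧≤ : ∀ {φ ψ χ} → Holds (m□ φ) → Holds (m□ ψ) → f∧ (e φ) (e ψ) ≤M e χ →
                Holds (m□ χ)
    holds-□∧≤ p q h = holds-∧≤ p q (□-∧ ⨾ □-mono h)

    holds-⊤ : Holds m⊤
    holds-⊤ = theorems m⊤ NEC-⊤

    ¬holds-both : ∀ {φ} → Holds (m¬ φ) → ¬ Holds φ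
    ¬holds-both p q = consistent (holds-∧≤ p q (∧-comm-≤ ⨾ ∧-complement))

    holds? : Decidable Holds
    holds? φ with complete φ
    ... | inj₁ p = yes p
    ... | inj₂ p = no (¬holds-both p)

  open World

  Accessible : World → World → Set
  Accessible v u = ∀ φ → Holds v (m□ φ) → Holds u φ

  -- The witness world collects the θ with □(αₙ ⇒ θ) ∈ v for some stage αₙ of a
  -- Lindenbaum chain starting from ¬φ; a stage α is Bad when □¬α ∈ v.
  module Witness (v : World) (φ : MFm) (¬□φ : ¬ Holds v (m□ φ)) where
    Bad : MFm → Set
    Bad α = Holds v (m□ (m¬ α))

    bad-split : ∀ α θ → Bad (α m∧ θ) → Bad (α m∧ m¬ θ) → Bad α
    bad-split α θ p q = holds-□∧≤ v p q (¬-intro (by-cases (e θ)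
      (¬-elim (∧-greatest (x∧y≤x ⨾ x∧y≤y) x∧y≤y) (x∧y≤x ⨾ x∧y≤x ⨾ x∧y≤x))
      (¬-elim (∧-greatest (x∧y≤x ⨾ x∧y≤y) x∧y≤y) (x∧y≤x ⨾ x∧y≤x ⨾ x∧y≤y))))

    open Lindenbaum D (boolPre normal) γ Bad (λ α → holds? v (m□ (m¬ α))) bad-split

    α : ℕ → MFm
    α = chain (m¬ φ)

    α-good : ∀ n → ¬ Bad (α n)
    α-good n = chain-good n (λ bad → ¬□φ (holds-□≤ v bad ¬¬-elim))

    holds-□-of-valid : ∀ {χ} → f⊤ ≤M e χ → Holds v (m□ χ)
    holds-□-of-valid h = theorems v _ (NEC-□ (⊤≤⇒NEC h))

    α-antitone : ∀ {k l} → k ≤ l → e (α l) ≤M e (α k)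
    α-antitone k≤l = chain-antitone (m¬ φ) (≤⇒≤′ k≤l)

    witness : World
    Holds witness θ = ∃[ n ] Holds v (m□ (α n m⇒ θ))
    theorems witness θ h = zero , holds-□-of-valid (⇒-intro (x∧y≤x ⨾ NEC⇒⊤≤ h))
    mp witness θ χ (m , p) (n , q) = m ⊔ n , holds-□∧≤ v p q (⇒-intro
      (⇒-elim (⇒-elim (x∧y≤y ⨾ α-antitone (m≤n⊔m m n)) (x∧y≤x ⨾ x∧y≤y))
              (⇒-elim (x∧y≤y ⨾ α-antitone (m≤m⊔n m n)) (x∧y≤x ⨾ x∧y≤x))))
    consistent witness (n , p) = α-good n (holds-□≤ v p (¬-intro (⇒-elim x∧y≤y x∧y≤x)))
    complete witness θ = decided (chain-decides (m¬ φ) θ)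
      where
      decided : ∃[ n ] Decides (α n) θ → Holds witness θ ⊎ Holds witness (m¬ θ)
      decided (n , inj₁ h) = inj₁ (n , holds-□-of-valid (⇒-intro (x∧y≤y ⨾ h)))
      decided (n , inj₂ h) = inj₂ (n , holds-□-of-valid (⇒-intro (x∧y≤y ⨾ h)))

    accessible : Accessible v witness
    accessible ψ p = zero , holds-□≤ v p (⇒-intro x∧y≤x)

    ¬witness-φ : ¬ Holds witness φ
    ¬witness-φ (n , p) = α-good n (holds-□≤ v p (¬-intro
      (¬-elim (⇒-elim x∧y≤y x∧y≤x) (x∧y≤y ⨾ α-antitone (z≤n {n})))))

  existence : ∀ v φ → ¬ Holds v (m□ φ) → Σ World λ u → Accessible v u × ¬ Holds u φ
  existence v φ ¬□φ = witness , accessible , ¬witness-φ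
    where open Witness v φ ¬□φ

  canonicalFrame : S4Frame
  canonicalFrame = record
    { W     = World
    ; R     = λ v u → Lift _ (Accessible v u)
    ; refl  = λ v → lift (λ φ p → holds-≤ v p □-T)
    ; trans = λ u v w (lift r) (lift s) → lift (λ φ p → s φ (r (m□ φ) (holds-≤ u p □-4)))
    }

  valuation : ℕ → World → Set
  valuation p v = Holds v (mvar p)

  open Kripke canonicalFrame

  forces⇒holds : ∀ v φ → v , valuation ⊩ φ → Holds v φ
  holds⇒forces : ∀ v φ → Holds v φ → v , valuation ⊩ φ

  forces⇒holds v (mvar p) f = lower f
  forces⇒holds v m⊥ (lift ())
  forces⇒holds v m⊤ _ = holds-⊤ v
  forces⇒holds v (m¬ φ) ¬f with complete v φ
  ... | inj₁ p = ⊥-elim (¬f (holds⇒forces v φ p))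
  ... | inj₂ p = p
  forces⇒holds v (φ m⇒ ψ) f with complete v φ
  ... | inj₁ p = holds-≤ v (forces⇒holds v ψ (f (holds⇒forces v φ p))) (⇒-intro x∧y≤x)
  ... | inj₂ p = holds-≤ v p (⇒-intro (¬-elim x∧y≤y x∧y≤x ⨾ ⊥-least))
  forces⇒holds v (φ m∨ ψ) (inj₁ f) = holds-≤ v (forces⇒holds v φ f) x≤x∨y
  forces⇒holds v (φ m∨ ψ) (inj₂ f) = holds-≤ v (forces⇒holds v ψ f) y≤x∨y
  forces⇒holds v (φ m∧ ψ) (f , f') =
    holds-∧≤ v (forces⇒holds v φ f) (forces⇒holds v ψ f') ≤-refl
  forces⇒holds v (m□ φ) f with holds? v (m□ φ)
  ... | yes p = p
  ... | no ¬p with existence v φ ¬p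
  ... | u , v≺u , ¬q = ⊥-elim (¬q (forces⇒holds u φ (f u (lift v≺u))))

  holds⇒forces v (mvar p) = lift
  holds⇒forces v m⊥ p = ⊥-elim (consistent v p)
  holds⇒forces v m⊤ _ = lift tt
  holds⇒forces v (m¬ φ) p f = ¬holds-both v p (forces⇒holds v φ f)
  holds⇒forces v (φ m⇒ ψ) p f = holds⇒forces v ψ (mp v φ ψ p (forces⇒holds v φ f))
  holds⇒forces v (φ m∨ ψ) p with complete v φ
  ... | inj₁ q = inj₁ (holds⇒forces v φ q)
  ... | inj₂ q = inj₂ (holds⇒forces v ψ
                  (holds-∧≤ v q p (∨-elim (∧-comm-≤ ⨾ ∧-complement ⨾ ⊥-least) x∧y≤y)))
  holds⇒forces v (φ m∧ ψ) p = holds⇒forces v φ (holds-≤ v p x∧y≤x)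
                            , holds⇒forces v ψ (holds-≤ v p x∧y≤y)
  holds⇒forces v (m□ φ) p u (lift v≺u) = holds⇒forces u φ (v≺u φ p)

  actual : World
  Holds      actual φ = γ ⊨ ι φ
  theorems   actual φ = NEC⊆TRUE normal (e φ)
  mp         actual φ ψ = proj₁ (⇒-true (e φ) (e ψ))
  consistent actual = ⊥-false
  complete   actual φ = TRUE-or-TRUE-¬ (e φ)

  actual-truth : ∀ φ → (γ ⊨ ι φ) ⇔ (actual , valuation ⊩ φ)
  actual-truth φ = holds⇒forces actual φ , forces⇒holds actual φ

  identity⇒forces-□↔ : ∀ φ ψ → γ ⊨ (ι φ ≡' ι ψ) → actual , valuation ⊩ m□ (φ m↔ ψ)
  identity⇒forces-□↔ φ ψ t = holds⇒forces actual (m□ (φ m↔ ψ)) (proj₂ (□-true _)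
    (subst (λ b → NEC (f∧ (f⇒ (e φ) b) (f⇒ b (e φ)))) (proj₁ (≡-true _ _) t) ↔-refl))
    where
    ↔-refl : NEC (f∧ (f⇒ (e φ) (e φ)) (f⇒ (e φ) (e φ)))
    ↔-refl = ⊤≤⇒NEC (∧-greatest (⇒-intro x∧y≤y) (⇒-intro x∧y≤y))

  forces-□↔⇒identity : SatisfiesCollapse → IsBooleanAlgebraM →
                        ∀ φ ψ → actual , valuation ⊩ m□ (φ m↔ ψ) → γ ⊨ (ι φ ≡' ι ψ)
  forces-□↔⇒identity collapse (isBA , ⇒-def) φ ψ f =
    proj₂ (≡-true _ _) ([∁x∨y]∧[∁y∨x]≈⊤⇒x≈y algebra (e φ) (e ψ) ∨-form≡⊤)
    where
    algebra : BooleanAlgebra _ _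
    algebra = record { _≈_ = _≡_ ; _∨_ = f∨ ; _∧_ = f∧ ; ¬_ = f¬ ; ⊤ = f⊤ ; ⊥ = f⊥
                     ; isBooleanAlgebra = isBA }
    □↔ : TRUE (f□ (e (φ m↔ ψ)))
    □↔ = forces⇒holds actual (m□ (φ m↔ ψ)) f
    φ↔ψ≡⊤ : e (φ m↔ ψ) ≡ f⊤
    φ↔ψ≡⊤ = proj₁ (≡-true _ _) (proj₁ (⇒-true _ _) (collapse (ι (φ m↔ ψ)) ⊤' γ)
             (proj₂ (∧-true _ _) (□↔ , proj₂ (□-true f⊤) NEC-⊤)))
    ∨-form≡⊤ : f∧ (f∨ (f¬ (e φ)) (e ψ)) (f∨ (f¬ (e ψ)) (e φ)) ≡ f⊤
    ∨-form≡⊤ = trans (sym (cong₂ f∧ (⇒-def (e φ) (e ψ)) (⇒-def (e ψ) (e φ)))) φ↔ψ≡⊤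

theorem35 : (C : Set) (D : PropDomain C) (γ : ℕ → PropDomain.M D) →
    Semantics.IsS4Model D →
    Σ S4Frame λ F → Σ (ℕ → S4Frame.W F → Set) λ g → Σ (S4Frame.W F) λ w →
      ((φ : MFm) →
          (Semantics._⊨_ D γ (ι φ) ⇔ Kripke._,_⊩_ F w g φ))
      × ((φ ψ : MFm) →
          Semantics._⊨_ D γ (ι φ ≡' ι ψ) →
          Kripke._,_⊩_ F w g (m□ (φ m↔ ψ)))
      × (Semantics.SatisfiesCollapse D →
          Semantics.IsBooleanAlgebraM D →
          (φ ψ : MFm) →
          Kripke._,_⊩_ F w g (m□ (φ m↔ ψ)) →
          Semantics._⊨_ D γ (ι φ ≡' ι ψ))
theorem35 C D γ S4 =
  canonicalFrame , valuation , actual , actual-truth , identity⇒forces-□↔ , forces-□↔⇒identity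
  where open Canonical D S4 γ
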